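{- Let $M$ be a multiline queue and $1\le i<n$ with $e^{\leftarrow}_i(M)\neq M$, and let $r$ be the row in which $M$ and $e^{\leftarrow}_i(M)$ differ. Then $L_M(s,i+1)=L_M(r,i+1)$ for all sites $(s,i+1)\in\mathrm{act}_i(M)$.
   Context: Fix $n$. For a partition $\lambda$ with $L=\lambda_1$, $n>\ell(\lambda)$, a multiline queue (MLQ) of shape $\lambda$ is a tuple $M=(B_1,\dots,B_L)$ of subsets of $[n]$ with $|B_r|=\lambda'_r$, pictured as an array with rows $1..L$ bottom to top, columns $1..n$ left to right cyclically, ball at $(r,j)$ iff $j\in B_r$. FM labelling: for $r=L,\dots,2$: unlabelled balls of row $r$ get label $r$; then balls of row $r$ in order of decreasing label (left to right among equals) are each paired with the first not-yet-paired ball of row $r-1$ weakly to the right (cyclically), which gets the same label. Remaining balls of row 1 get label 1. $L_M(s,j)$ is the label at site $(s,j)$, 0 if no ball. Bracketing w.r.t. $i$: $i\mapsto$ ")", $i+1\mapsto$ "(", others ignored; iteratively match "(" with a ")" to its right when no unmatched parenthesis lies between. $rw(M)$ lists column indices of balls, rows top to bottom, each row right to left. $e^{\leftarrow}_i(M)$ moves the ball of the leftmost unmatched $i+1$ of $rw(M)$ from column $i+1$ to column $i$ in the same row (identity if none). $i$-active region: if $e^{\leftarrow}_i(M)\neq M$, let the moved ball be at site $(r,i+1)$ with label $\ell$; let $p\le r$ be maximal such that $L_M(p-1,i)=0$ or $L_M(p-1,i)\ge\ell$ ($p=1$ if none); $\mathrm{act}_i(M)=\{(s,j):p\le s\le r,\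 j\in\{i,i+1\}\}$. -}

module Defs where

open import Data.Bool using (Bool; true; false; if_then_else_; _∧_; _∨_; not)
open import Data.Nat using (ℕ; zero; suc; _∸_; _≤_; _<_; _≤?_; _≟_; _≡ᵇ_; _≤ᵇ_)
open import Data.List using (List; []; _∷_; _++_; length; filter; map; concatMap; reverse; upTo; downFrom; [_])
open import Data.List.Relation.Unary.All using (All)
open import Data.List.Relation.Unary.Linked using (Linked)
open import Data.Maybe using (Maybe; just; nothing)
open import Data.Product using (_×_; _,_)
open import Data.Sum using (_⊎_)
open import Data.Empty using (⊥)
open import Data.Fin using (Fin; toℕ)
open import Data.Fin.Subset using (Subset; ∣_∣)
import Data.Fin.Subset as S
open import Data.Vec using (Vec; []; _∷_; lookup; toList)
open import Relation.Binary.PropositionalEquality using (_≡_)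

record Partition : Set where
  field
    parts      : List ℕ
    decreasing : Linked (λ a b → b ≤ a) parts
    positive   : All (λ a → 1 ≤ a) parts
open Partition public

firstPart : Partition → ℕ
firstPart p with parts p
... | []    = 0
... | a ∷ _ = a

partLength : Partition → ℕ
partLength p = length (parts p)

conj : Partition → ℕ → ℕ
conj p r = length (filter (λ a → r ≤? a) (parts p))

-- Rows are subsets of [n] (as Subset n, column j
-- corresponds to the Fin index j-1).  rows is indexed bottom-up:
-- the Fin index k stands for row k+1, so the vector is (B_1,...,B_L).

record MLQ (n : ℕ) (lam : Partition) : Set where
  field
    rows : Vec (Subset n) (firstPart lam)
    card : (k : Fin (firstPart lam)) → ∣ lookup rows k ∣ ≡ conj lam (suc (toℕ k))
open MLQ public

Rows : ℕ → ℕ → Set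
Rows n L = Vec (Subset n) L

-- Elementary access, 1-indexed; out-of-range gives false / empty row.

colAt : ∀ {m} → Vec Bool m → ℕ → Bool
colAt []      _             = false
colAt (b ∷ v) zero          = false
colAt (b ∷ v) (suc zero)    = b
colAt (b ∷ v) (suc (suc k)) = colAt v (suc k)

setCol : ∀ {m} → Vec Bool m → ℕ → Bool → Vec Bool m
setCol []      _             c = []
setCol (b ∷ v) zero          c = b ∷ v
setCol (b ∷ v) (suc zero)    c = c ∷ v
setCol (b ∷ v) (suc (suc k)) c = b ∷ setCol v (suc k) c

rowAt : ∀ {n L} → Rows n L → ℕ → Subset n
rowAt []       _             = S.⊥
rowAt (x ∷ xs) zero          = S.⊥
rowAt (x ∷ xs) (suc zero)    = x
rowAt (x ∷ xs) (suc (suc k)) = rowAt xs (suc k)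

modRow : ∀ {n L} → Rows n L → ℕ → (Subset n → Subset n) → Rows n L
modRow []       _             f = []
modRow (x ∷ xs) zero          f = x ∷ xs
modRow (x ∷ xs) (suc zero)    f = f x ∷ xs
modRow (x ∷ xs) (suc (suc k)) f = x ∷ modRow xs (suc k) f

cols : ℕ → List ℕ
cols n = map suc (upTo n)

-- FM labelling.  A labelled row is a function column ↦ label (0 = no ball).

cyc : ℕ → ℕ → List ℕ
cyc n c = filter (λ d → c ≤? d) (cols n) ++ filter (λ d → suc d ≤? c) (cols n)

firstWhere : (ℕ → Bool) → List ℕ → Maybe ℕ
firstWhere P []       = nothing
firstWhere P (d ∷ ds) = if P d then just d else firstWhere P ds

update : (ℕ → ℕ) → ℕ → ℕ → (ℕ → ℕ)
update f d v x = if x ≡ᵇ d then v else f x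

ballOrder : ℕ → ℕ → (ℕ → ℕ) → List ℕ
ballOrder n L lab =
  concatMap (λ v → filter (λ j → lab j ≟ v) (cols n)) (map suc (downFrom L))

-- pair the balls of the (fully labelled) upper row, taken in the given
-- order, with balls of the lower row; the state P records the labels handed
-- down so far (0 = not yet paired)
pairAll : ∀ {n} → (ℕ → ℕ) → Subset n → List ℕ → (ℕ → ℕ) → (ℕ → ℕ)
pairAll {n} lab below []       P = P
pairAll {n} lab below (c ∷ cs) P with firstWhere (λ d → colAt below d ∧ (P d ≡ᵇ 0)) (cyc n c)
... | nothing = pairAll lab below cs P
... | just d  = pairAll lab below cs (update P d (lab c))

stepDown : ∀ {n} → ℕ → ℕ → (ℕ → ℕ) → Subset n → (ℕ → ℕ)
stepDown {n} L r lab below d =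
  let P = pairAll lab below (ballOrder n L lab) (λ _ → 0) in
  if colAt below d then (if P d ≡ᵇ 0 then r ∸ 1 else P d) else 0

labelsDown : ∀ {n} → ℕ → ℕ → (ℕ → ℕ) → List (Subset n) → List (ℕ → ℕ)
labelsDown L r lab []       = lab ∷ []
labelsDown L r lab (b ∷ bs) = lab ∷ labelsDown L (r ∸ 1) (stepDown L r lab b) bs

-- labels of all rows, listed top-down (row L first)
labelsTopDown : ∀ {n L} → Rows n L → List (ℕ → ℕ)
labelsTopDown {n} {L} B with reverse (toList B)
... | []     = []
... | t ∷ ts = labelsDown L L (λ d → if colAt t d then L else 0) ts

nthLab : List (ℕ → ℕ) → ℕ → (ℕ → ℕ)
nthLab []       _       = λ _ → 0
nthLab (f ∷ fs) zero    = f
nthLab (f ∷ fs) (suc k) = nthLab fs k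

-- L_M(s,j): label at site (s,j), 0 if there is no ball (or out of range)
labelAt : ∀ {n L} → Rows n L → ℕ → ℕ → ℕ
labelAt {n} {L} B s j = if (1 ≤ᵇ s) ∧ (s ≤ᵇ L) then nthLab (labelsTopDown B) (L ∸ s) j else 0

-- rw(M) as a list of sites (row, column): rows top to bottom, each row right to left
readingSites : ∀ {n L} → Rows n L → List (ℕ × ℕ)
readingSites {n} {L} B =
  concatMap (λ s → concatMap (λ j → if colAt (rowAt B s) j then (s , j) ∷ [] else [])
                              (reverse (cols n)))
            (map suc (downFrom L))

-- bracketing w.r.t. i: column i is ")", column i+1 is "("; the stack holds the
-- rows of the currently unmatched "(" (most recent on top)
bracketScan : ℕ → List (ℕ × ℕ) → List ℕ → List ℕ
bracketScan i []              st = st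
bracketScan i ((s , j) ∷ ws) st =
  if j ≡ᵇ suc i then bracketScan i ws (s ∷ st)
  else (if j ≡ᵇ i then bracketScan i ws (pop st) else bracketScan i ws st)
  where
  pop : List ℕ → List ℕ
  pop []       = []
  pop (_ ∷ xs) = xs

lastM : List ℕ → Maybe ℕ
lastM []           = nothing
lastM (x ∷ [])     = just x
lastM (x ∷ y ∷ xs) = lastM (y ∷ xs)

-- row of the leftmost unmatched i+1 in rw(M), if any
movedRow : ∀ {n L} → ℕ → Rows n L → Maybe ℕ
movedRow i B = lastM (bracketScan i (readingSites B) [])

eLeft : ∀ {n L} → ℕ → Rows n L → Rows n L
eLeft i B with movedRow i B
... | nothing = B
... | just r  = modRow B r (λ row → setCol (setCol row (suc i) false) i true)

actBottom : ∀ {n L} → Rows n L → ℕ → ℕ → ℕ → ℕ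
actBottom B i ℓ zero          = 1
actBottom B i ℓ (suc zero)    = 1
actBottom B i ℓ (suc (suc q)) =
  if (labelAt B (suc q) i ≡ᵇ 0) ∨ (ℓ ≤ᵇ labelAt B (suc q) i)
  then suc (suc q) else actBottom B i ℓ (suc q)

InAct : ∀ {n L} → ℕ → Rows n L → ℕ → ℕ → Set
InAct i B s j with movedRow i B
... | nothing = ⊥
... | just r  = (actBottom B i (labelAt B r (suc i)) r ≤ s) × (s ≤ r) × ((j ≡ i) ⊎ (j ≡ suc i))

-- Let ℓ be the label of the moved ball at (r, i+1) and p the bottom of the active region,
-- so each row s with p ≤ s < r has a ball in column i whose label is below ℓ. The "(" of
-- row r stays unmatched to the end of the reading word, so the ")" of each of these rows
-- is matched inside its own row: the row also has a ball in column i+1. Going down from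
-- row r, the ball at (s+1, i+1) passes ℓ on to (s, i+1): the balls paired before it all
-- have label ≥ ℓ and, searching cyclically to the right from a column other than i+1,
-- reach column i before column i+1; so had (s, i+1) been taken first, (s, i) would carry
-- a label ≥ ℓ.

module Submission where

open import Defs
open import Data.Bool using (Bool; true; false; if_then_else_; _∧_; _∨_)
open import Data.Bool.Properties using (T-≡)
open import Data.Empty using (⊥; ⊥-elim)
open import Data.Fin.Subset using (Subset)
import Data.Fin.Subset as Subset
open import Data.List using (List; []; _∷_; _++_; _∷ʳ_; length; reverse; filter; concatMap; map; drop; applyUpTo; applyDownFrom; downFrom)
open import Data.List.Properties using (map-upTo; unfold-reverse; length-reverse; reverse-applyUpTo)
open import Data.List.Relation.Unary.All using (All; []; _∷_)
import Data.List.Relation.Unary.All as All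
open import Data.List.Relation.Unary.Any using (here; there)
import Data.List.Relation.Unary.Any as Any
open import Data.List.Membership.Propositional using (_∈_)
open import Data.List.Relation.Unary.All.Properties using (all-filter)
open import Data.List.Relation.Unary.First using (First; [_]; _∷_)
import Data.List.Relation.Unary.First as First
open import Data.List.Relation.Unary.First.Properties using (++⁺; ⁺++)
open import Data.Maybe using (just; nothing)
open import Data.Maybe.Properties using (just-injective)
open import Data.Nat using (ℕ; zero; suc; _+_; _∸_; _≤_; _<_; _≤?_; _<?_; _≟_; _≡ᵇ_; _≤ᵇ_; z≤n; s≤s)
open import Data.Nat.Properties
open import Data.Vec using (toList; []; _∷_)
open import Data.Vec.Properties using (length-toList)
open import Data.Product using (Σ; _×_; _,_; proj₁; proj₂)
open import Data.Sum using (_⊎_; inj₁; inj₂; [_,_]′)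
open import Function.Bundles using (Equivalence)
open import Relation.Nullary using (yes; no; contradiction)
open import Relation.Unary using (Decidable)
open import Relation.Binary.PropositionalEquality
open import Function using (_∘_)

≡ᵇ≡true⇒≡ : ∀ {m n} → (m ≡ᵇ n) ≡ true → m ≡ n
≡ᵇ≡true⇒≡ {m} {n} e = ≡ᵇ⇒≡ m n (Equivalence.from T-≡ e)

≡ᵇ-refl : ∀ m → (m ≡ᵇ m) ≡ true
≡ᵇ-refl m = Equivalence.to T-≡ (≡⇒≡ᵇ m m refl)

≢⇒≡ᵇ≡false : ∀ {m n} → m ≢ n → (m ≡ᵇ n) ≡ false
≢⇒≡ᵇ≡false {m} {n} m≢n with m ≡ᵇ n in e
... | true  = contradiction (≡ᵇ≡true⇒≡ e) m≢n
... | false = refl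

First-filter⁺ : ∀ {G R : ℕ → Set} (R? : Decidable R) {t xs} → R t →
                First G (_≡ t) xs → First (λ a → G a × R a) (_≡ t) (filter R? xs)
First-filter⁺ R? {t} Rt [ refl ] with R? t
... | yes _  = [ refl ]
... | no ¬Rt = contradiction Rt ¬Rt
First-filter⁺ R? Rt (_∷_ {a} Ga f) with R? a
... | yes Ra = (Ga , Ra) ∷ First-filter⁺ R? Rt f
... | no _   = First-filter⁺ R? Rt f

firstWhere-sound : ∀ p xs {d} → firstWhere p xs ≡ just d → p d ≡ true
firstWhere-sound p (x ∷ xs) e with p x in px
firstWhere-sound p (x ∷ xs) refl | true = px
... | false = firstWhere-sound p xs e

firstWhere-first : ∀ {G : ℕ → Set} p {t} xs → First G (_≡ t) xs →
                   (∀ {a} → G a → p a ≡ false) → p t ≡ true → firstWhere p xs ≡ just t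
firstWhere-first p (t ∷ _) [ refl ] ¬p pt rewrite pt = refl
firstWhere-first p (a ∷ xs) (Ga ∷ f) ¬p pt rewrite ¬p Ga = firstWhere-first p xs f ¬p pt

firstWhere-not-after : ∀ {G : ℕ → Set} p {t u} xs → First G (_≡ t) xs →
                       p t ≡ true → firstWhere p xs ≡ just u → G u ⊎ u ≡ t
firstWhere-not-after p (t ∷ _) [ refl ] pt e rewrite pt = inj₂ (sym (just-injective e))
firstWhere-not-after p (a ∷ xs) (Ga ∷ f) pt e with p a
... | true  = inj₁ (subst _ (just-injective e) Ga)
... | false = firstWhere-not-after p xs f pt e

-- Columns

applyUpTo-First : ∀ (f : ℕ → ℕ) a k {t} → (∀ x → f x ≡ a + x) → a ≤ t → t < a + k →
                  First (_< t) (_≡ t) (applyUpTo f k)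
applyUpTo-First f a zero hf a≤t t<a+0 = contradiction (≤-trans t<a+0 (≤-reflexive (+-identityʳ a))) (≤⇒≯ a≤t)
applyUpTo-First f a (suc k) {t} hf a≤t t<a+k with a ≟ t | trans (hf 0) (+-identityʳ a)
... | yes refl | f0≡a = [ f0≡a ]
... | no a≢t   | f0≡a = subst (_< t) (sym f0≡a) a<t ∷
      applyUpTo-First (λ x → f (suc x)) (suc a) k (λ x → trans (hf (suc x)) (+-suc a x)) a<t (subst (t <_) (+-suc a k) t<a+k)
  where a<t = ≤∧≢⇒< a≤t a≢t

cols-First : ∀ n {t} → 1 ≤ t → t ≤ n → First (_< t) (_≡ t) (cols n)
cols-First n 1≤t t≤n rewrite map-upTo suc n = applyUpTo-First suc 1 n (λ _ → refl) 1≤t (s≤s t≤n)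

cyc-starts-with : ∀ n {c} → 1 ≤ c → c ≤ n → First (λ _ → ⊥) (_≡ c) (cyc n c)
cyc-starts-with n {c} 1≤c c≤n =
  ⁺++ (First.map₁ (λ (a<c , c≤a) → <⇒≱ a<c c≤a) (First-filter⁺ (c ≤?_) ≤-refl (cols-First n 1≤c c≤n))) _

cyc-visits-i-before-suc-i : ∀ n {c i} → c ≢ suc i → 1 ≤ i → i < n →
                            First (_≢ suc i) (_≡ i) (cyc n c)
cyc-visits-i-before-suc-i n {c} {i} c≢ 1≤i i<n with c ≤? i | cols-First n 1≤i (<⇒≤ i<n)
... | yes c≤i | colsᵢ = ⁺++ (First.map₁ (λ (a<i , _) → <⇒≢ (m<n⇒m<1+n a<i)) (First-filter⁺ (c ≤?_) c≤i colsᵢ)) _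
... | no c≰i  | colsᵢ = ++⁺ (All.map (λ {a} c≤a a≡ → c≢ (≤-antisym (subst (c ≤_) a≡ c≤a) (≰⇒> c≰i))) (all-filter (c ≤?_) (cols n)))
                    (First.map₁ (λ (a<i , _) → <⇒≢ (m<n⇒m<1+n a<i)) (First-filter⁺ (λ d → suc d ≤? c) (≰⇒> c≰i) colsᵢ))

-- Pairing

update-≡ : ∀ P d v → update P d v d ≡ v
update-≡ P d v rewrite ≡ᵇ-refl d = refl

update-≢ : ∀ P {d x} v → x ≢ d → update P d v x ≡ P x
update-≢ P v x≢d rewrite ≢⇒≡ᵇ≡false x≢d = refl

module Pairing {n : ℕ} (lab : ℕ → ℕ) (below : Subset n) where

  free : (ℕ → ℕ) → ℕ → Bool
  free P d = colAt below d ∧ (P d ≡ᵇ 0)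

  pairStep : (ℕ → ℕ) → ℕ → (ℕ → ℕ)
  pairStep P c with firstWhere (free P) (cyc n c)
  ... | nothing = P
  ... | just d  = update P d (lab c)

  pairAll-∷ : ∀ c cs P → pairAll lab below (c ∷ cs) P ≡ pairAll lab below cs (pairStep P c)
  pairAll-∷ c cs P with firstWhere (free P) (cyc n c)
  ... | nothing = refl
  ... | just d  = refl

  free⇒unpaired : ∀ P d → free P d ≡ true → P d ≡ 0
  free⇒unpaired P d e with colAt below d | e
  ... | true  | e′ = ≡ᵇ≡true⇒≡ e′

  unpaired⇒free : ∀ P {d} → colAt below d ≡ true → P d ≡ 0 → free P d ≡ true
  unpaired⇒free P ball unpaired rewrite ball | unpaired = refl

  pairStep-keeps : ∀ P c {d} → P d ≢ 0 → pairStep P c d ≡ P d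
  pairStep-keeps P c {d} Pd≢0 with firstWhere (free P) (cyc n c) in eq
  ... | nothing = refl
  ... | just d′ = update-≢ P (lab c) λ d≡d′ →
        Pd≢0 (free⇒unpaired P d (subst (λ x → free P x ≡ true) (sym d≡d′) (firstWhere-sound (free P) (cyc n c) eq)))

  pairAll-keeps : ∀ xs P {d} → P d ≢ 0 → pairAll lab below xs P d ≡ P d
  pairAll-keeps []       P _ = refl
  pairAll-keeps (c ∷ cs) P {d} Pd≢0 = begin
    pairAll lab below (c ∷ cs) P d        ≡⟨ cong-app (pairAll-∷ c cs P) d ⟩
    pairAll lab below cs (pairStep P c) d ≡⟨ pairAll-keeps cs _ (subst (_≢ 0) (sym kept) Pd≢0) ⟩
    pairStep P c d                        ≡⟨ kept ⟩
    P d                                   ∎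
    where
    open ≡-Reasoning
    kept = pairStep-keeps P c Pd≢0

  pairStep-≤ : ∀ {L} P c → (∀ d → P d ≤ L) → lab c ≤ L → ∀ d → pairStep P c d ≤ L
  pairStep-≤ P c P≤ lab≤ d with firstWhere (free P) (cyc n c)
  ... | nothing = P≤ d
  ... | just d′ with d ≡ᵇ d′
  ...   | true  = lab≤
  ...   | false = P≤ d

  pairAll-≤ : ∀ {L} xs P → (∀ d → P d ≤ L) → (∀ c → lab c ≤ L) → ∀ d → pairAll lab below xs P d ≤ L
  pairAll-≤ []       P P≤ _    d = P≤ d
  pairAll-≤ (c ∷ cs) P P≤ lab≤ d rewrite pairAll-∷ c cs P = pairAll-≤ cs _ (pairStep-≤ P c P≤ (lab≤ c)) lab≤ d

  module _ {i : ℕ} (1≤i : 1 ≤ i) (i<n : i < n) (lab-suc-i≢0 : lab (suc i) ≢ 0)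
           (ball-i : colAt below i ≡ true) (ball-suc-i : colAt below (suc i) ≡ true) where

    private
      ℓ : ℕ
      ℓ = lab (suc i)

    -- Preserved as long as the balls processed have label ≥ ℓ and, not starting at column
    -- i+1, meet column i before column i+1 in their cyclic search.
    Guarded : (ℕ → ℕ) → Set
    Guarded P = (P (suc i) ≢ 0 → P i ≢ 0) × (P i ≢ 0 → ℓ ≤ P i)

    pairStep-Guarded : ∀ P {c} → ℓ ≤ lab c → c ≢ suc i → Guarded P → Guarded (pairStep P c)
    pairStep-Guarded P {c} ℓ≤lab c≢suc-i (inv₁ , inv₂) with firstWhere (free P) (cyc n c) in eq
    ... | nothing = inv₁ , inv₂
    ... | just d  = inv₁′ , inv₂′
      where
      P′ = update P d (lab c)

      inv₂′ : P′ i ≢ 0 → ℓ ≤ P′ i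
      inv₂′ with i ≟ d
      ... | yes refl = λ _ → subst (ℓ ≤_) (sym (update-≡ P d (lab c))) ℓ≤lab
      ... | no i≢d   = subst (λ x → x ≢ 0 → ℓ ≤ x) (sym (update-≢ P (lab c) i≢d)) inv₂

      inv₁′ : P′ (suc i) ≢ 0 → P′ i ≢ 0
      inv₁′ with i ≟ d
      ... | yes refl = λ _ → subst (_≢ 0) (sym (update-≡ P d (lab c))) (λ lab≡0 → lab-suc-i≢0 (n≤0⇒n≡0 (subst (ℓ ≤_) lab≡0 ℓ≤lab)))
      ... | no i≢d with suc i ≟ d
      ...   | no suc-i≢d = subst₂ (λ x y → x ≢ 0 → y ≢ 0) (sym (update-≢ P (lab c) suc-i≢d)) (sym (update-≢ P (lab c) i≢d)) inv₁
      ...   | yes refl = λ _ → subst (_≢ 0) (sym (update-≢ P (lab c) i≢d)) λ Pi≡0 →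
                [ (λ suc-i≢suc-i → suc-i≢suc-i refl) , 1+n≢n ]′
                  (firstWhere-not-after (free P) (cyc n c) (cyc-visits-i-before-suc-i n c≢suc-i 1≤i i<n)
                     (unpaired⇒free P ball-i Pi≡0) eq)

    first-free-at-suc-i : ∀ P → Guarded P → P i ≡ 0 → firstWhere (free P) (cyc n (suc i)) ≡ just (suc i)
    first-free-at-suc-i P (inv₁ , _) Pi≡0 with P (suc i) ≟ 0
    ... | no Psuc-i≢0 = contradiction Pi≡0 (inv₁ Psuc-i≢0)
    ... | yes Psuc-i≡0 =
      firstWhere-first (free P) (cyc n (suc i)) (cyc-starts-with n (s≤s z≤n) i<n) (λ ()) (unpaired⇒free P ball-suc-i Psuc-i≡0)

    pairStep-hands-down : ∀ P → Guarded P → P i ≡ 0 → pairStep P (suc i) (suc i) ≡ ℓ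
    pairStep-hands-down P g Pi≡0 with firstWhere (free P) (cyc n (suc i)) | first-free-at-suc-i P g Pi≡0
    ... | just _ | refl = update-≡ P (suc i) ℓ

    pairAll-splits : ∀ xs P → First (λ a → ℓ ≤ lab a × a ≢ suc i) (_≡ suc i) xs → Guarded P →
                     pairAll lab below xs P (suc i) ≡ ℓ ⊎ ℓ ≤ pairAll lab below xs P i
    pairAll-splits (c ∷ cs) P ((ℓ≤lab , c≢suc-i) ∷ f) g rewrite pairAll-∷ c cs P =
      pairAll-splits cs _ f (pairStep-Guarded P ℓ≤lab c≢suc-i g)
    pairAll-splits (_ ∷ cs) P [ refl ] g with P i ≟ 0
    ... | no Pi≢0  = inj₂ (subst (ℓ ≤_) (sym (pairAll-keeps _ P Pi≢0)) (proj₂ g Pi≢0))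
    ... | yes Pi≡0 = inj₁ (begin
      pairAll lab below (suc i ∷ cs) P (suc i)        ≡⟨ cong-app (pairAll-∷ (suc i) cs P) (suc i) ⟩
      pairAll lab below cs (pairStep P (suc i)) (suc i) ≡⟨ pairAll-keeps cs _ (subst (_≢ 0) (sym handed) lab-suc-i≢0) ⟩
      pairStep P (suc i) (suc i)                      ≡⟨ handed ⟩
      ℓ                                               ∎)
      where
      open ≡-Reasoning
      handed = pairStep-hands-down P g Pi≡0

ballOrder-First : ∀ n L (lab : ℕ → ℕ) {i} → i < n → lab (suc i) ≢ 0 → lab (suc i) ≤ L →
                  First (λ a → lab (suc i) ≤ lab a × a ≢ suc i) (_≡ suc i) (ballOrder n L lab)
ballOrder-First n zero    lab i<n ℓ≢0 ℓ≤0 = contradiction (n≤0⇒n≡0 ℓ≤0) ℓ≢0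
ballOrder-First n (suc L) lab {i} i<n ℓ≢0 ℓ≤1+L with lab (suc i) ≟ suc L
... | yes ℓ≡1+L = ⁺++ (First.map₁ (λ (a<1+i , lab≡1+L) → ≤-reflexive (trans ℓ≡1+L (sym lab≡1+L)) , <⇒≢ a<1+i)
                         (First-filter⁺ (λ j → lab j ≟ suc L) ℓ≡1+L (cols-First n (s≤s z≤n) i<n))) _
... | no ℓ≢1+L  = let ℓ≤L = ≤-pred (≤∧≢⇒< ℓ≤1+L ℓ≢1+L) in
  ++⁺ (All.map (λ {a} lab≡1+L → ≤-trans (m≤n⇒m≤1+n ℓ≤L) (≤-reflexive (sym lab≡1+L)) ,
                               λ a≡1+i → ℓ≢1+L (trans (cong lab (sym a≡1+i)) lab≡1+L))
               (all-filter (λ j → lab j ≟ suc L) (cols n)))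
      (ballOrder-First n L lab i<n ℓ≢0 ℓ≤L)

stepDown-inherits-label : ∀ {n} L r (lab : ℕ → ℕ) (below : Subset n) {i} → 1 ≤ i → i < n →
  colAt below i ≡ true → colAt below (suc i) ≡ true → lab (suc i) ≢ 0 → lab (suc i) ≤ L →
  stepDown L r lab below i < lab (suc i) → stepDown L r lab below (suc i) ≡ lab (suc i)
stepDown-inherits-label {n} L r lab below {i} 1≤i i<n ball-i ball-suc-i ℓ≢0 ℓ≤L below-i<ℓ
  with Pairing.pairAll-splits lab below 1≤i i<n ℓ≢0 ball-i ball-suc-i (ballOrder n L lab) (λ _ → 0)
         (ballOrder-First n L lab i<n ℓ≢0 ℓ≤L) ((λ 0≢0 → contradiction refl 0≢0) , (λ 0≢0 → contradiction refl 0≢0))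
... | inj₁ inherited rewrite ball-suc-i | inherited | ≢⇒≡ᵇ≡false ℓ≢0 = refl
... | inj₂ ℓ≤paired rewrite ball-i with pairAll lab below (ballOrder n L lab) (λ _ → 0) i ≡ᵇ 0 in unpaired
...   | true  = contradiction (n≤0⇒n≡0 (subst (_ ≤_) (≡ᵇ≡true⇒≡ unpaired) ℓ≤paired)) ℓ≢0
...   | false = contradiction ℓ≤paired (<⇒≱ below-i<ℓ)

-- Rows and their labels

lookupOr : ∀ {A : Set} → A → List A → ℕ → A
lookupOr d []       _       = d
lookupOr d (x ∷ xs) zero    = x
lookupOr d (x ∷ xs) (suc k) = lookupOr d xs k

lookupOr-++ˡ : ∀ {A : Set} (d : A) xs ys {k} → k < length xs → lookupOr d (xs ++ ys) k ≡ lookupOr d xs k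
lookupOr-++ˡ d (x ∷ xs) ys {zero}  _         = refl
lookupOr-++ˡ d (x ∷ xs) ys {suc k} (s≤s k<) = lookupOr-++ˡ d xs ys k<

lookupOr-∷ʳ : ∀ {A : Set} (d : A) xs y → lookupOr d (xs ∷ʳ y) (length xs) ≡ y
lookupOr-∷ʳ d []       y = refl
lookupOr-∷ʳ d (x ∷ xs) y = lookupOr-∷ʳ d xs y

∸-suc : ∀ {m k} → k < m → m ∸ k ≡ suc (m ∸ suc k)
∸-suc {suc m} k<1+m = +-∸-assoc 1 (≤-pred k<1+m)

lookupOr-reverse : ∀ {A : Set} (d : A) xs {k} → k < length xs →
                   lookupOr d (reverse xs) k ≡ lookupOr d xs (length xs ∸ suc k)
lookupOr-reverse d (x ∷ xs) {k} k<1+len rewrite unfold-reverse x xs with k <? length xs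
... | yes k<len = begin
  lookupOr d (reverse xs ∷ʳ x) k            ≡⟨ lookupOr-++ˡ d (reverse xs) _ (subst (k <_) (sym (length-reverse xs)) k<len) ⟩
  lookupOr d (reverse xs) k                 ≡⟨ lookupOr-reverse d xs k<len ⟩
  lookupOr d xs (length xs ∸ suc k)         ≡⟨ cong (lookupOr d (x ∷ xs)) (∸-suc k<len) ⟨
  lookupOr d (x ∷ xs) (length xs ∸ k)       ∎
  where open ≡-Reasoning
... | no k≮len with ≤-antisym (≤-pred k<1+len) (≮⇒≥ k≮len)
...   | refl rewrite n∸n≡0 (length xs) = subst (λ k → lookupOr d (reverse xs ∷ʳ x) k ≡ x) (length-reverse xs) (lookupOr-∷ʳ d (reverse xs) x)

rowAt-toList : ∀ {n L} (B : Rows n L) s → rowAt B (suc s) ≡ lookupOr Subset.⊥ (toList B) s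
rowAt-toList []      _       = refl
rowAt-toList (x ∷ B) zero    = refl
rowAt-toList (x ∷ B) (suc s) = rowAt-toList B s

rowAt-reverse : ∀ {n L} (B : Rows n L) {s} → s < L →
                rowAt B (suc s) ≡ lookupOr Subset.⊥ (reverse (toList B)) (L ∸ suc s)
rowAt-reverse {L = suc L} B {s} s<1+L = begin
  rowAt B (suc s)                                               ≡⟨ rowAt-toList B s ⟩
  lookupOr Subset.⊥ (toList B) s                                ≡⟨ cong (lookupOr Subset.⊥ (toList B)) index ⟨
  lookupOr Subset.⊥ (toList B) (length (toList B) ∸ suc (L ∸ s)) ≡⟨ lookupOr-reverse Subset.⊥ (toList B) depth<length ⟨
  lookupOr Subset.⊥ (reverse (toList B)) (L ∸ s)                ∎
  where
  open ≡-Reasoning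
  depth<length : L ∸ s < length (toList B)
  depth<length rewrite length-toList B = s≤s (m∸n≤m L s)
  index : length (toList B) ∸ suc (L ∸ s) ≡ s
  index rewrite length-toList B = m∸[m∸n]≡n (≤-pred s<1+L)

-- The k-th labelled row counted from the top (k = 0 is row L).
rowLabels : ∀ {n L} → Rows n L → ℕ → (ℕ → ℕ)
rowLabels B k = nthLab (labelsTopDown B) k

labelsDown-step : ∀ {n} L r lab (ts : List (Subset n)) {k} → k < length ts →
  nthLab (labelsDown L r lab ts) (suc k) ≡ stepDown L (r ∸ k) (nthLab (labelsDown L r lab ts) k) (lookupOr Subset.⊥ ts k)
labelsDown-step L r lab (b ∷ []) {zero} _ = refl
labelsDown-step L r lab (b ∷ _ ∷ _) {zero} _ = refl
labelsDown-step L r lab (b ∷ bs) {suc k} (s≤s k<) =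
  trans (labelsDown-step L (r ∸ 1) (stepDown L r lab b) bs k<)
        (cong (λ r′ → stepDown L r′ (nthLab (labelsDown L (r ∸ 1) (stepDown L r lab b) bs) k) (lookupOr Subset.⊥ bs k))
              (∸-+-assoc r 1 k))

rowLabels-step : ∀ {n L} (B : Rows n L) {k} → suc k < L →
  rowLabels B (suc k) ≡ stepDown L (L ∸ k) (rowLabels B k) (lookupOr Subset.⊥ (reverse (toList B)) (suc k))
rowLabels-step {L = L} B {k} 1+k<L with reverse (toList B) | length-reverse (toList B) | length-toList B
... | []     | len-rev | len = contradiction (subst (suc k <_) (sym (trans len-rev len)) 1+k<L) λ ()
... | t ∷ ts | len-rev | len = labelsDown-step L L _ ts (≤-pred (subst (suc k <_) (sym (trans len-rev len)) 1+k<L))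

≤⇒≤ᵇ≡true : ∀ {m n} → m ≤ n → (m ≤ᵇ n) ≡ true
≤⇒≤ᵇ≡true m≤n = Equivalence.to T-≡ (≤⇒≤ᵇ m≤n)

labelAt-rowLabels : ∀ {n L} (B : Rows n L) {s} j → 1 ≤ s → s ≤ L → labelAt B s j ≡ rowLabels B (L ∸ s) j
labelAt-rowLabels B j 1≤s s≤L rewrite ≤⇒≤ᵇ≡true 1≤s | ≤⇒≤ᵇ≡true s≤L = refl

labelAt-step : ∀ {n L} (B : Rows n L) {s} j → 1 ≤ s → s < L →
               labelAt B s j ≡ stepDown L (suc s) (rowLabels B (L ∸ suc s)) (rowAt B s) j
labelAt-step {L = L} B {suc s} j _ s<L = begin
  labelAt B (suc s) j                         ≡⟨ labelAt-rowLabels B j (s≤s z≤n) (<⇒≤ s<L) ⟩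
  rowLabels B (L ∸ suc s) j                   ≡⟨ cong (λ k → rowLabels B k j) (∸-suc s<L) ⟩
  rowLabels B (suc (L ∸ suc (suc s))) j       ≡⟨ cong-app (rowLabels-step B (subst (_< L) (∸-suc s<L) (∸-monoʳ-< {L} (s≤s z≤n) (<⇒≤ s<L)))) j ⟩
  stepDown L (L ∸ (L ∸ suc (suc s))) (rowLabels B (L ∸ suc (suc s))) (lookupOr Subset.⊥ rev (suc (L ∸ suc (suc s)))) j
    ≡⟨ cong₂ (λ r b → stepDown L r (rowLabels B (L ∸ suc (suc s))) b j) (m∸[m∸n]≡n s<L)
             (trans (cong (lookupOr Subset.⊥ rev) (sym (∸-suc s<L))) (sym (rowAt-reverse B (≤-trans (n≤1+n _) s<L)))) ⟩
  stepDown L (suc (suc s)) (rowLabels B (L ∸ suc (suc s))) (rowAt B (suc s)) j ∎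
  where
  open ≡-Reasoning
  rev = reverse (toList B)

labelsDown-head : ∀ {n} L r lab (ts : List (Subset n)) → nthLab (labelsDown L r lab ts) 0 ≡ lab
labelsDown-head L r lab []      = refl
labelsDown-head L r lab (_ ∷ _) = refl

labelAt-top : ∀ {n L} (B : Rows n L) j → 1 ≤ L → labelAt B L j ≡ (if colAt (rowAt B L) j then L else 0)
labelAt-top {L = suc L} B j _ rewrite labelAt-rowLabels B j (s≤s z≤n) ≤-refl | n∸n≡0 L | rowAt-reverse B (n<1+n L) | n∸n≡0 L
  with reverse (toList B) | length-reverse (toList B) | length-toList B
... | []     | len-rev | len = contradiction (trans len-rev len) λ ()
... | t ∷ ts | _       | _   = cong-app (labelsDown-head (suc L) (suc L) _ ts) j

if-then-else-0-≢0 : ∀ b {x} → (if b then x else 0) ≢ 0 → b ≡ true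
if-then-else-0-≢0 true  _   = refl
if-then-else-0-≢0 false ≢0 = contradiction refl ≢0

if-then-else-0-≤ : ∀ b x → (if b then x else 0) ≤ x
if-then-else-0-≤ true  _ = ≤-refl
if-then-else-0-≤ false _ = z≤n

labelAt≢0⇒ball : ∀ {n L} (B : Rows n L) {s} j → 1 ≤ s → s ≤ L → labelAt B s j ≢ 0 → colAt (rowAt B s) j ≡ true
labelAt≢0⇒ball {L = L} B {s} j 1≤s s≤L ≢0 with s <? L
... | yes s<L = if-then-else-0-≢0 (colAt (rowAt B s) j) (subst (_≢ 0) (labelAt-step B j 1≤s s<L) ≢0)
... | no s≮L with ≤-antisym s≤L (≮⇒≥ s≮L)
...   | refl = if-then-else-0-≢0 (colAt (rowAt B s) j) (subst (_≢ 0) (labelAt-top B j 1≤s) ≢0)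

stepDown-≤ : ∀ {n} L r lab (below : Subset n) → r ≤ L → (∀ j → lab j ≤ L) → ∀ j → stepDown L r lab below j ≤ L
stepDown-≤ {n} L r lab below r≤L lab≤ j with colAt below j
... | false = z≤n
... | true with pairAll lab below (ballOrder n L lab) (λ _ → 0) j ≡ᵇ 0
...   | true  = ≤-trans (m∸n≤m r 1) r≤L
...   | false = Pairing.pairAll-≤ lab below (ballOrder n L lab) (λ _ → 0) (λ _ → z≤n) lab≤ j

labelsDown-≤ : ∀ {n} L r lab (ts : List (Subset n)) → r ≤ L → (∀ j → lab j ≤ L) →
               ∀ k j → nthLab (labelsDown L r lab ts) k j ≤ L
labelsDown-≤ L r lab []       r≤L lab≤ zero    j = lab≤ j
labelsDown-≤ L r lab []       r≤L lab≤ (suc k) j = z≤n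
labelsDown-≤ L r lab (t ∷ ts) r≤L lab≤ zero    j = lab≤ j
labelsDown-≤ L r lab (t ∷ ts) r≤L lab≤ (suc k) j =
  labelsDown-≤ L (r ∸ 1) (stepDown L r lab t) ts (≤-trans (m∸n≤m r 1) r≤L) (stepDown-≤ L r lab t r≤L lab≤) k j

labelAt-≤ : ∀ {n L} (B : Rows n L) s j → labelAt B s j ≤ L
labelAt-≤ {L = L} B s j with (1 ≤ᵇ s) ∧ (s ≤ᵇ L)
... | false = z≤n
... | true with reverse (toList B)
...   | []     = z≤n
...   | t ∷ ts = labelsDown-≤ L L _ ts ≤-refl (λ d → if-then-else-0-≤ (colAt t d) L) (L ∸ s) j

-- Bracketing

bracketScan-++ : ∀ i xs ys st → bracketScan i (xs ++ ys) st ≡ bracketScan i ys (bracketScan i xs st)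
bracketScan-++ i []             ys st = refl
bracketScan-++ i ((s , j) ∷ xs) ys st with j ≡ᵇ suc i
... | true  = bracketScan-++ i xs ys (s ∷ st)
... | false with j ≡ᵇ i
...   | true  = bracketScan-++ i xs ys _
...   | false = bracketScan-++ i xs ys st

lastM-∈ : ∀ xs {r} → lastM xs ≡ just r → r ∈ xs
lastM-∈ (x ∷ [])     refl = here refl
lastM-∈ (x ∷ y ∷ xs) e    = there (lastM-∈ (y ∷ xs) e)

pushIf : Bool → ℕ → List ℕ → List ℕ
pushIf b t st = if b then t ∷ st else st

popIf : Bool → List ℕ → List ℕ
popIf b st = if b then drop 1 st else st

module Bracketing {n L : ℕ} (B : Rows n L) {i : ℕ} (1≤i : 1 ≤ i) (i<n : i < n) where

  Ball : ℕ → ℕ → Set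
  Ball s j = colAt (rowAt B s) j ≡ true

  site : ℕ → ℕ → List (ℕ × ℕ)
  site s j = if colAt (rowAt B s) j then (s , j) ∷ [] else []

  columnScan : ℕ → ℕ → List ℕ → List ℕ
  columnScan t k = bracketScan i (concatMap (site t) (applyDownFrom suc k))

  columnScan-suc : ∀ t k st → columnScan t (suc k) st ≡ columnScan t k (bracketScan i (site t (suc k)) st)
  columnScan-suc t k st = bracketScan-++ i (site t (suc k)) _ st

  site-ignored : ∀ t {c} st → c ≢ i → c ≢ suc i → bracketScan i (site t c) st ≡ st
  site-ignored t {c} st c≢i c≢suc-i with colAt (rowAt B t) c
  ... | false = refl
  ... | true rewrite ≢⇒≡ᵇ≡false c≢suc-i | ≢⇒≡ᵇ≡false c≢i = refl

  site-open : ∀ t st → bracketScan i (site t (suc i)) st ≡ pushIf (colAt (rowAt B t) (suc i)) t st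
  site-open t st with colAt (rowAt B t) (suc i)
  ... | false = refl
  ... | true rewrite ≡ᵇ-refl i = refl

  site-close : ∀ t st → bracketScan i (site t i) st ≡ popIf (colAt (rowAt B t) i) st
  site-close t st with colAt (rowAt B t) i
  ... | false = refl
  ... | true rewrite ≢⇒≡ᵇ≡false (<⇒≢ (n<1+n i)) | ≡ᵇ-refl i with st
  ...   | []    = refl
  ...   | _ ∷ _ = refl

  columnScan-left : ∀ t k st → k < i → columnScan t k st ≡ st
  columnScan-left t zero    st _   = refl
  columnScan-left t (suc k) st k<i = begin
    columnScan t (suc k) st                              ≡⟨ columnScan-suc t k st ⟩
    columnScan t k (bracketScan i (site t (suc k)) st)  ≡⟨ cong (columnScan t k) (site-ignored t st (<⇒≢ k<i) (<⇒≢ (m<n⇒m<1+n k<i))) ⟩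
    columnScan t k st                                    ≡⟨ columnScan-left t k st (<-trans (n<1+n k) k<i) ⟩
    st                                                   ∎
    where open ≡-Reasoning

  columnScan-right : ∀ t k st → suc i ≤ k → columnScan t k st ≡ columnScan t (suc i) st
  columnScan-right t (suc k) st 1+i≤1+k with k ≟ i
  ... | yes refl = refl
  ... | no k≢i = begin
    columnScan t (suc k) st                              ≡⟨ columnScan-suc t k st ⟩
    columnScan t k (bracketScan i (site t (suc k)) st)  ≡⟨ cong (columnScan t k) (site-ignored t st (>⇒≢ 1+i≤1+k) (k≢i ∘ suc-injective)) ⟩
    columnScan t k st                                    ≡⟨ columnScan-right t k st (≤∧≢⇒< (≤-pred 1+i≤1+k) (k≢i ∘ sym)) ⟩
    columnScan t (suc i) st                              ∎
    where open ≡-Reasoning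

  columnScan-closing : ∀ t k st → 1 ≤ k → k ≡ i → columnScan t k st ≡ popIf (colAt (rowAt B t) i) st
  columnScan-closing t (suc k) st _ refl = begin
    columnScan t (suc k) st                              ≡⟨ columnScan-suc t k st ⟩
    columnScan t k (bracketScan i (site t (suc k)) st)  ≡⟨ cong (columnScan t k) (site-close t st) ⟩
    columnScan t k (popIf (colAt (rowAt B t) i) st)     ≡⟨ columnScan-left t k _ ≤-refl ⟩
    popIf (colAt (rowAt B t) i) st                       ∎
    where open ≡-Reasoning

  -- A row is read right to left, so its "(" in column i+1 is pushed before its ")" in column i pops.
  rowStep : ℕ → List ℕ → List ℕ
  rowStep t st = popIf (colAt (rowAt B t) i) (pushIf (colAt (rowAt B t) (suc i)) t st)

  rowSites : ℕ → List (ℕ × ℕ)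
  rowSites t = concatMap (site t) (reverse (cols n))

  rowSites-scan : ∀ t st → bracketScan i (rowSites t) st ≡ rowStep t st
  rowSites-scan t st = begin
    bracketScan i (rowSites t) st                          ≡⟨ cong (λ cs → bracketScan i (concatMap (site t) cs) st) reverse-cols ⟩
    columnScan t n st                                      ≡⟨ columnScan-right t n st i<n ⟩
    columnScan t (suc i) st                                ≡⟨ columnScan-suc t i st ⟩
    columnScan t i (bracketScan i (site t (suc i)) st)    ≡⟨ cong (columnScan t i) (site-open t st) ⟩
    columnScan t i (pushIf (colAt (rowAt B t) (suc i)) t st) ≡⟨ columnScan-closing t i _ 1≤i refl ⟩
    rowStep t st                                           ∎
    where
    open ≡-Reasoning
    reverse-cols : reverse (cols n) ≡ applyDownFrom suc n
    reverse-cols = trans (cong reverse (map-upTo suc n)) (reverse-applyUpTo suc n)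

  -- The stack of unmatched "(" after reading rows k, k-1, …, 1 on top of st.
  scanRows : ℕ → List ℕ → List ℕ
  scanRows k = bracketScan i (concatMap rowSites (map suc (downFrom k)))

  scanRows-suc : ∀ k st → scanRows (suc k) st ≡ scanRows k (rowStep (suc k) st)
  scanRows-suc k st = trans (bracketScan-++ i (rowSites (suc k)) _ st) (cong (scanRows k) (rowSites-scan (suc k) st))

  movedRow-∈ : ∀ {r} → movedRow i B ≡ just r → r ∈ scanRows L []
  movedRow-∈ = lastM-∈ (scanRows L [])

  ∈-drop₁ : ∀ {x : ℕ} st → x ∈ drop 1 st → x ∈ st
  ∈-drop₁ (_ ∷ _) x∈ = there x∈

  ∉-above : ∀ {r : ℕ} {X} → All (r <_) X → r ∈ X → ⊥
  ∉-above r<X r∈X = <-irrefl refl (All.lookup r<X r∈X)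

  ∈-rowStep : ∀ {x} t st → x ∈ rowStep t st → x ≡ t ⊎ x ∈ st
  ∈-rowStep t st x∈ with colAt (rowAt B t) i | colAt (rowAt B t) (suc i)
  ... | false | false = inj₂ x∈
  ... | false | true  = Any.toSum x∈
  ... | true  | false = inj₂ (∈-drop₁ st x∈)
  ... | true  | true  = inj₂ x∈

  ∈-scanRows : ∀ {x} k st → x ∈ scanRows k st → x ∈ st ⊎ x ≤ k
  ∈-scanRows zero    st x∈ = inj₁ x∈
  ∈-scanRows (suc k) st x∈ rewrite scanRows-suc k st with ∈-scanRows k (rowStep (suc k) st) x∈
  ... | inj₂ x≤k = inj₂ (m≤n⇒m≤1+n x≤k)
  ... | inj₁ x∈′ = [ inj₂ ∘ ≤-reflexive , inj₁ ]′ (∈-rowStep (suc k) st x∈′)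

  ∈-scanRows-above : ∀ {x} k st → x ∈ scanRows k st → k < x → x ∈ st
  ∈-scanRows-above k st x∈ k<x = [ (λ x∈st → x∈st) , (λ x≤k → contradiction x≤k (<⇒≱ k<x)) ]′ (∈-scanRows k st x∈)

  rowStep-above : ∀ k st → All (suc k <_) st → All (k <_) (rowStep (suc k) st)
  rowStep-above k st above = All.tabulate λ x∈ →
    [ (λ x≡1+k → ≤-reflexive (sym x≡1+k)) , (λ x∈st → <-trans (n<1+n k) (All.lookup above x∈st)) ]′ (∈-rowStep (suc k) st x∈)

  scanRows-split : ∀ {k} m st → k ≤ m → All (m <_) st →
                   Σ (List ℕ) λ st′ → All (k <_) st′ × scanRows m st ≡ scanRows k st′
  scanRows-split {k} m st k≤m above with k ≟ m
  ... | yes refl = st , above , refl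
  scanRows-split zero    st k≤0 above | no k≢0 = contradiction (n≤0⇒n≡0 k≤0) k≢0
  scanRows-split (suc m) st k≤1+m above | no k≢1+m
    with scanRows-split m (rowStep (suc m) st) (≤-pred (≤∧≢⇒< k≤1+m k≢1+m)) (rowStep-above m st above)
  ... | st′ , above′ , e = st′ , above′ , trans (scanRows-suc m st) e

  opening-row : ∀ {r} st → All (r <_) st → r ∈ rowStep r st → rowStep r st ≡ r ∷ st
  opening-row {r} st above r∈ with colAt (rowAt B r) i | colAt (rowAt B r) (suc i)
  ... | false | true  = refl
  ... | false | false = ⊥-elim (∉-above above r∈)
  ... | true  | false = ⊥-elim (∉-above above (∈-drop₁ st r∈))
  ... | true  | true  = ⊥-elim (∉-above above r∈)

  moved-row-opens : ∀ {r} → suc r ∈ scanRows L [] → suc r ≤ L →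
                    Σ (List ℕ) λ X → All (suc r <_) X × suc r ∈ scanRows r (suc r ∷ X)
  moved-row-opens {r} r∈ 1+r≤L with scanRows-split L [] 1+r≤L []
  ... | st , above , e = st , above , subst (λ st′ → suc r ∈ scanRows r st′) (opening-row st above r∈row) r∈rows
    where
    r∈rows : suc r ∈ scanRows r (rowStep (suc r) st)
    r∈rows = subst (suc r ∈_) (trans e (scanRows-suc r st)) r∈
    r∈row : suc r ∈ rowStep (suc r) st
    r∈row = ∈-scanRows-above r _ r∈rows ≤-refl

  rowStep-matched : ∀ t st → Ball t i → Ball t (suc i) → rowStep t st ≡ st
  rowStep-matched t st ball-i ball-suc-i rewrite ball-i | ball-suc-i = refl

  rowStep-closing : ∀ t st → Ball t i → colAt (rowAt B t) (suc i) ≡ false → rowStep t st ≡ drop 1 st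
  rowStep-closing t st ball-i no-ball rewrite ball-i | no-ball = refl

  open-row-passes : ∀ {r X} u → u < r → All (r <_) X → r ∈ scanRows (suc u) (r ∷ X) → Ball (suc u) i →
                    Ball (suc u) (suc i) × r ∈ scanRows u (r ∷ X)
  open-row-passes {r} {X} u u<r above r∈ ball-i with colAt (rowAt B (suc u)) (suc i) in ball-suc-i
  ... | false = ⊥-elim (∉-above above (subst (r ∈_) (rowStep-closing (suc u) (r ∷ X) ball-i ball-suc-i) r∈row))
    where r∈row = ∈-scanRows-above u _ (subst (r ∈_) (scanRows-suc u (r ∷ X)) r∈) u<r
  ... | true  = refl , subst (λ st → r ∈ scanRows u st) (rowStep-matched (suc u) (r ∷ X) ball-i ball-suc-i)
                             (subst (r ∈_) (scanRows-suc u (r ∷ X)) r∈)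

  open-row-stays-open : ∀ {r X} u → u < r → All (r <_) X → r ∈ scanRows u (r ∷ X) →
                        ∀ {s} → 1 ≤ s → s ≤ u → (∀ {v} → s ≤ v → v ≤ u → Ball v i) → Ball s (suc i)
  open-row-stays-open zero _ _ _ 1≤s s≤0 _ = contradiction (≤-trans 1≤s s≤0) λ ()
  open-row-stays-open (suc u) 1+u<r above r∈ {s} 1≤s s≤1+u closes
    with open-row-passes u (<-trans (n<1+n u) 1+u<r) above r∈ (closes s≤1+u ≤-refl) | s ≟ suc u
  ... | ball , _  | yes refl = ball
  ... | _    , r∈′ | no s≢1+u =
    open-row-stays-open u (<-trans (n<1+n u) 1+u<r) above r∈′ 1≤s (≤-pred (≤∧≢⇒< s≤1+u s≢1+u))
                        (λ s≤v v≤u → closes s≤v (m≤n⇒m≤1+n v≤u))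

  unmatched-above : ∀ {r} → r ∈ scanRows L [] → r ≤ L → ∀ {s} → 1 ≤ s → s < r →
                    (∀ {v} → s ≤ v → v < r → Ball v i) → Ball s (suc i)
  unmatched-above {suc r} r∈ r≤L 1≤s s<r closes with moved-row-opens r∈ r≤L
  ... | X , above , r∈′ = open-row-stays-open r ≤-refl above r∈′ 1≤s (≤-pred s<r) (λ s≤v v≤r → closes s≤v (s≤s v≤r))

-- The active region

nonzero-below-of-no-stop : ∀ {ℓ} x → ((x ≡ᵇ 0) ∨ (ℓ ≤ᵇ x)) ≡ false → x ≢ 0 × x < ℓ
nonzero-below-of-no-stop {ℓ} (suc x) stop≡false = (λ ()) , ≰⇒> (λ ℓ≤1+x → contradiction (trans (sym stop≡false) (≤⇒≤ᵇ≡true ℓ≤1+x)) λ ())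

module _ {n L} (B : Rows n L) (i ℓ : ℕ) where

  actBottom-pos : ∀ r → 1 ≤ actBottom B i ℓ r
  actBottom-pos zero          = ≤-refl
  actBottom-pos (suc zero)    = ≤-refl
  actBottom-pos (suc (suc q)) with (labelAt B (suc q) i ≡ᵇ 0) ∨ (ℓ ≤ᵇ labelAt B (suc q) i) | actBottom-pos (suc q)
  ... | true  | _   = s≤s z≤n
  ... | false | pos = pos

  actBottom-below : ∀ r {s} → actBottom B i ℓ r ≤ s → s < r → labelAt B s i ≢ 0 × labelAt B s i < ℓ
  actBottom-below (suc zero)    p≤s (s≤s s≤0) = contradiction (≤-trans p≤s s≤0) λ ()
  actBottom-below (suc (suc q)) {s} p≤s s<r
    with (labelAt B (suc q) i ≡ᵇ 0) ∨ (ℓ ≤ᵇ labelAt B (suc q) i) in stop | actBottom-below (suc q) {s}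
  ... | true  | _     = contradiction p≤s (<⇒≱ s<r)
  ... | false | below with s ≟ suc q
  ...   | yes refl   = nonzero-below-of-no-stop (labelAt B s i) stop
  ...   | no s≢1+q = below p≤s (≤∧≢⇒< (≤-pred s<r) s≢1+q)

rowAt-modRow-≢ : ∀ {n L} (B : Rows n L) {r r′} f → r ≢ r′ → rowAt (modRow B r′ f) r ≡ rowAt B r
rowAt-modRow-≢ []      f _ = refl
rowAt-modRow-≢ (x ∷ B) {_}           {zero}        f _  = refl
rowAt-modRow-≢ (x ∷ B) {zero}        {suc zero}    f _  = refl
rowAt-modRow-≢ (x ∷ B) {zero}        {suc (suc _)} f _  = refl
rowAt-modRow-≢ (x ∷ B) {suc zero}    {suc zero}    f ne = contradiction refl ne
rowAt-modRow-≢ (x ∷ B) {suc (suc _)} {suc zero}    f _  = refl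
rowAt-modRow-≢ (x ∷ B) {suc zero}    {suc (suc _)} f _  = refl
rowAt-modRow-≢ (x ∷ B) {suc (suc r)} {suc (suc _)} f ne = rowAt-modRow-≢ B f (ne ∘ cong suc)

module _ {n L} (B : Rows n L) {i} (1≤i : 1 ≤ i) (i<n : i < n)
         {r} (moved : movedRow i B ≡ just r) (r≤L : r ≤ L) where

  open Bracketing B 1≤i i<n

  private
    ℓ : ℕ
    ℓ = labelAt B r (suc i)

  label-descends : ∀ {s} → actBottom B i ℓ r ≤ s → s < r → labelAt B (suc s) (suc i) ≡ ℓ →
                   labelAt B s (suc i) ≡ ℓ
  label-descends {s} p≤s s<r above≡ℓ = begin
    labelAt B s (suc i)                             ≡⟨ labelAt-step B (suc i) 1≤s s<L ⟩
    stepDown L (suc s) labAbove (rowAt B s) (suc i) ≡⟨ stepDown-inherits-label L (suc s) labAbove (rowAt B s) 1≤i i<n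
                                                         ball-i ball-suc-i (ℓ≢0 ∘ trans (sym labAbove≡ℓ)) labAbove≤L i-below ⟩
    labAbove (suc i)                                ≡⟨ labAbove≡ℓ ⟩
    ℓ                                               ∎
    where
    open ≡-Reasoning
    labAbove = rowLabels B (L ∸ suc s)
    1≤s = ≤-trans (actBottom-pos B i ℓ r) p≤s
    s<L = <-≤-trans s<r r≤L
    closes : ∀ {v} → s ≤ v → v < r → Ball v i
    closes s≤v v<r = labelAt≢0⇒ball B i (≤-trans 1≤s s≤v) (≤-trans (<⇒≤ v<r) r≤L)
                                      (proj₁ (actBottom-below B i ℓ r (≤-trans p≤s s≤v) v<r))
    ball-i = closes ≤-refl s<r
    ball-suc-i = unmatched-above (movedRow-∈ moved) r≤L 1≤s s<r closes
    ℓ≢0 : ℓ ≢ 0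
    ℓ≢0 ℓ≡0 = n≮0 (subst (_ <_) ℓ≡0 (proj₂ (actBottom-below B i ℓ r p≤s s<r)))
    labAbove≡ℓ : labAbove (suc i) ≡ ℓ
    labAbove≡ℓ = trans (sym (labelAt-rowLabels B (suc i) (s≤s z≤n) s<L)) above≡ℓ
    labAbove≤L = subst (_≤ L) (sym labAbove≡ℓ) (labelAt-≤ B r (suc i))
    i-below : stepDown L (suc s) labAbove (rowAt B s) i < labAbove (suc i)
    i-below = subst₂ _<_ (labelAt-step B i 1≤s s<L) (sym labAbove≡ℓ) (proj₂ (actBottom-below B i ℓ r p≤s s<r))

  active-column-constant : ∀ k {s} → s + k ≡ r → actBottom B i ℓ r ≤ s → labelAt B s (suc i) ≡ ℓ
  active-column-constant zero    {s} s+0≡r _   = cong (λ x → labelAt B x (suc i)) (trans (sym (+-identityʳ s)) s+0≡r)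
  active-column-constant (suc k) {s} s+1+k≡r p≤s =
    label-descends p≤s (subst (s <_) s+1+k≡r (m<m+n s (s≤s z≤n)))
                   (active-column-constant k (trans (sym (+-suc s k)) s+1+k≡r) (m≤n⇒m≤1+n p≤s))

lemma3p8 : (n : ℕ) (lam : Partition) → partLength lam < n → (M : MLQ n lam)
         → (i : ℕ) → 1 ≤ i → i < n
         → eLeft i (rows M) ≢ rows M
         → (r : ℕ) → 1 ≤ r → r ≤ firstPart lam
         → rowAt (eLeft i (rows M)) r ≢ rowAt (rows M) r
         → (s : ℕ) → InAct i (rows M) s (suc i)
         → labelAt (rows M) s (suc i) ≡ labelAt (rows M) r (suc i)
lemma3p8 n lam _ M i 1≤i i<n moves r _ r≤L row-changes s in-act with movedRow i (rows M) in moved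
... | nothing = contradiction refl moves
... | just r′ with r ≟ r′
...   | no r≢r′ = contradiction (rowAt-modRow-≢ (rows M) _ r≢r′) row-changes
...   | yes refl with in-act
...     | p≤s , s≤r , _ = active-column-constant (rows M) 1≤i i<n moved r≤L (r ∸ s) (m+[n∸m]≡n s≤r) p≤s
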